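{- For all integers $r,t\ge 2$, $$ex_r(n,\{C_2,K_{2,t}\})\le \frac{\sqrt{t-1}}{r(r-1)}n^{3/2}+O(n),$$ where the constant in $O(n)$ depends only on $r$ and $t$.
   Context: All hypergraphs are simple (no repeated hyperedges). For a graph $F$, a hypergraph $\mathcal B$ is a Berge-$F$ if there is a bijection $\phi:E(F)\to E(\mathcal B)$ with $e\subseteq\phi(e)$ for every $e\in E(F)$. A Berge-$C_2$ consists of two distinct hyperedges both containing the same two distinct vertices; thus a hypergraph is Berge-$C_2$-free iff it is linear (any two distinct hyperedges share at most one vertex). For a family $\mathcal F$ of graphs, $ex_r(n,\mathcal F)$ denotes the maximum number of hyperedges in an $r$-uniform hypergraph on $n$ vertices containing no Berge-$F$ as a subhypergraph for every $F\in\mathcal F$. -}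

module Defs where

open import Data.Nat using (ℕ; _+_)
open import Data.Fin using (Fin; zero; suc; _↑ʳ_)
open import Data.Fin.Subset using (Subset; _∈_; ∣_∣)
open import Data.List using (List; []; _∷_; length; lookup; map; _++_; allFin)
open import Data.Product using (Σ; _×_; _,_; proj₁; proj₂)
open import Relation.Binary.PropositionalEquality using (_≡_)
open import Function.Definitions using (Injective)

-- A (multi)graph on vertex set Fin k, given by a list of edges (pairs of
-- endpoints); repeated entries are parallel edges (needed for C₂).
record Graph : Set where
  field
    k     : ℕ
    edges : List (Fin k × Fin k)

record Hypergraph (n r : ℕ) : Set where
  field
    m        : ℕ
    edge     : Fin m → Subset n
    simple   : Injective _≡_ _≡_ edge
    uniform  : (i : Fin m) → ∣ edge i ∣ ≡ r

-- H contains a Berge-F: an injective placement f of the vertices of F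
-- into V(H) and an injective map φ from E(F) to E(H) with each edge
-- {u,v} of F contained in φ({u,v}).
ContainsBerge : ∀ {n r} → Hypergraph n r → Graph → Set
ContainsBerge {n} H F =
  Σ (Fin k → Fin n) λ f → Injective _≡_ _≡_ f ×
  Σ (Fin (length edges) → Fin m) λ φ → Injective _≡_ _≡_ φ ×
  ((i : Fin (length edges)) →
     (f (proj₁ (lookup edges i)) ∈ edge (φ i)) ×
     (f (proj₂ (lookup edges i)) ∈ edge (φ i)))
  where
  open Graph F
  open Hypergraph H

C₂ : Graph
C₂ = record { k = 2 ; edges = (zero , suc zero) ∷ (zero , suc zero) ∷ [] }

K₂ : ℕ → Graph
K₂ t = record
  { k = 2 + t
  ; edges = map (λ j → (zero , 2 ↑ʳ j)) (allFin t)
         ++ map (λ j → (suc zero , 2 ↑ʳ j)) (allFin t) }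

module Submission where

-- A Berge-C₂-free hypergraph is linear.  Count Berge paths u – v – w of
-- length two, i.e. ordered pairs of distinct hyperedges e ∋ u, v and f ∋ v, w.
-- Through each vertex v there are deg(v)² - deg(v) pairs (e, f), each giving
-- (r-1)² paths, so by Cauchy–Schwarz (r-1)²(∑ deg)²/n ≤ #paths + O(m).  For a
-- fixed pair (u, w), the middle vertices v are "spokes" between u and w; a
-- maximal conflict-free family of spokes has fewer than t members, since t of
-- them would form a Berge-K_{2,t}.  Hence u, w have at most t-1 middles up to
-- "clashes" (two middles sharing a hyperedge with u or with w), and a second
-- application of the same fan argument shows the clashes total O(m).  As
-- ∑ deg = rm this gives (r(r-1)m)² ≤ (t-1)n³ + O(mn), which is the claim.

open import Defs
open import Level using (Level)
open import Data.Empty using (⊥-elim)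
open import Data.Product using (∃-syntax; _×_; _,_; proj₁; proj₂)
open import Data.Sum using (_⊎_; inj₁; inj₂)
open import Data.Nat using (ℕ; zero; suc; _+_; _*_; _∸_; _^_; _≤_; _<_; z≤n; s≤s; _≤?_)
open import Data.Nat.Properties
  using ( +-*-semiring; module ≤-Reasoning; ≤-reflexive; ≤-trans; ≤-antisym; ≤-total; ≰⇒>
        ; +-comm; +-identityʳ; +-mono-≤; +-monoˡ-≤; +-monoʳ-≤; +-cancelʳ-≤; m≤m+n; m≤n+m
        ; *-comm; *-identityˡ; *-identityʳ; *-zeroʳ; *-distribˡ-+; *-distribʳ-+
        ; *-mono-≤; *-monoˡ-≤; *-monoʳ-≤; *-cancelˡ-≤
        ; m+[n∸m]≡n; m+n∸n≡m; m∸n+n≡m; m≤n⇒m∸n≡0; ∸-monoˡ-≤ )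
open import Data.Nat.Tactic.RingSolver using (solve-∀)
open import Data.Fin as Fin using (Fin; zero; suc)
import Data.Fin.Properties as FinP
open FinP using (_≟_)
open import Data.Fin.Subset using (Subset; _∈_; ∣_∣; inside; outside)
open import Data.Fin.Subset.Properties using (_∈?_)
open import Data.Vec using ([]; _∷_)
open import Data.List using (List; []; _∷_; length; lookup; allFin)
open import Data.List.Relation.Unary.All as All using (All; []; _∷_)
open import Data.List.Relation.Unary.All.Properties as AllP using (¬Any⇒All¬)
open import Data.List.Relation.Unary.AllPairs using (AllPairs; []; _∷_)
import Data.List.Relation.Unary.AllPairs.Properties as APP
open import Data.List.Relation.Unary.Any as Any using (Any; here; there)
open import Data.List.Relation.Unary.Any.Properties using (lookup-index)
open import Data.List.Membership.Propositional using () renaming (_∈_ to _∈ₗ_)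
open import Data.List.Membership.Propositional.Properties using (∈-lookup; ∈-allFin)
open import Function.Definitions using (Injective)
open import Relation.Binary.Definitions using (tri<; tri≈; tri>)
open import Relation.Binary.PropositionalEquality
  using (_≡_; _≢_; refl; sym; trans; cong; cong₂; subst; subst₂; module ≡-Reasoning)
open import Relation.Nullary using (¬_; Dec; yes; no; map′; ¬?; _×-dec_; _⊎-dec_; contradiction)
open import Algebra.Properties.Semiring.Sum +-*-semiring
  using (sum; sum-syntax; sum-cong-≗; ∑-distrib-+; ∑-comm; *-distribˡ-sum; *-distribʳ-sum)

∑-mono : ∀ {k} {f g : Fin k → ℕ} → (∀ i → f i ≤ g i) → sum f ≤ sum g
∑-mono {zero} _ = z≤n
∑-mono {suc k} f≤g = +-mono-≤ (f≤g zero) (∑-mono (λ i → f≤g (suc i)))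

∑-const : ∀ k c → ∑[ i < k ] c ≡ k * c
∑-const zero c = refl
∑-const (suc k) c = cong (c +_) (∑-const k c)

term≤∑ : ∀ {k} (f : Fin k → ℕ) i → f i ≤ sum f
term≤∑ f zero = m≤m+n _ _
term≤∑ f (suc i) = ≤-trans (term≤∑ (λ j → f (suc j)) i) (m≤n+m _ _)

∑-pos : ∀ {k} (f : Fin k → ℕ) → 1 ≤ sum f → ∃[ i ] 1 ≤ f i
∑-pos {suc k} f pos with f zero in eq
... | suc _ = zero , subst (1 ≤_) (sym eq) (s≤s z≤n)
... | zero with ∑-pos (λ i → f (suc i)) pos
...   | i , fi = suc i , fi

∑-≤1 : ∀ {k} (f : Fin k → ℕ) → (∀ i → f i ≤ 1) →
       (∀ {i j} → 1 ≤ f i → 1 ≤ f j → i ≡ j) → sum f ≤ 1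
∑-≤1 {zero} f _ _ = z≤n
∑-≤1 {suc k} f ≤1 unique with f zero in eq
... | zero = ∑-≤1 (λ i → f (suc i)) (λ i → ≤1 (suc i)) (λ p q → FinP.suc-injective (unique p q))
... | suc a = subst (λ s → suc a + s ≤ 1) (sym others-vanish)
                (subst (_≤ 1) (trans eq (sym (+-identityʳ (suc a)))) (≤1 zero))
  where
  head-pos : 1 ≤ f zero
  head-pos = subst (1 ≤_) (sym eq) (s≤s z≤n)
  vanish : ∀ j → f (suc j) ≡ 0
  vanish j with f (suc j) in eq′
  ... | zero = refl
  ... | suc _ with unique head-pos (subst (1 ≤_) (sym eq′) (s≤s z≤n))
  ...   | ()
  others-vanish : sum (λ j → f (suc j)) ≡ 0
  others-vanish = trans (sum-cong-≗ vanish) (trans (∑-const k 0) (*-zeroʳ k))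

∑-comm₃ : ∀ {a b c} (F : Fin a → Fin b → Fin c → ℕ) →
          ∑[ x < a ] ∑[ y < b ] ∑[ z < c ] F x y z ≡ ∑[ y < b ] ∑[ z < c ] ∑[ x < a ] F x y z
∑-comm₃ F = trans (∑-comm (λ x y → ∑[ z < _ ] F x y z)) (sum-cong-≗ (λ y → ∑-comm (λ x z → F x y z)))

∑-product : ∀ {a b} (f : Fin a → ℕ) (g : Fin b → ℕ) → sum f * sum g ≡ ∑[ x < a ] ∑[ y < b ] (f x * g y)
∑-product f g = trans (*-distribʳ-sum (sum g) f) (sum-cong-≗ (λ x → *-distribˡ-sum (f x) g))

-- The AM–GM inequality 2ab ≤ a² + b², first for a ≤ b, writing b = a + d
-- so that a² + b² = 2ab + d².
2ab≤a²+b²-ordered : ∀ {a b} → a ≤ b → 2 * (a * b) ≤ a * a + b * b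
2ab≤a²+b²-ordered {a} {b} a≤b =
  subst (λ z → 2 * (a * z) ≤ a * a + z * z) (m+[n∸m]≡n a≤b)
        (subst (2 * (a * (a + d)) ≤_) (expand a d) (m≤m+n _ (d * d)))
  where
  d : ℕ
  d = b ∸ a
  expand : ∀ a d → 2 * (a * (a + d)) + d * d ≡ a * a + (a + d) * (a + d)
  expand = solve-∀

2ab≤a²+b² : ∀ a b → 2 * (a * b) ≤ a * a + b * b
2ab≤a²+b² a b with ≤-total a b
... | inj₁ a≤b = 2ab≤a²+b²-ordered a≤b
... | inj₂ b≤a = subst₂ _≤_ (cong (2 *_) (*-comm b a)) (+-comm (b * b) (a * a)) (2ab≤a²+b²-ordered b≤a)

-- Cauchy–Schwarz: (∑ fᵢ)² ≤ k ∑ fᵢ², from summing 2 fᵢ fⱼ ≤ fᵢ² + fⱼ² over all i, j.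
cauchy-schwarz : ∀ {k} (f : Fin k → ℕ) → sum f * sum f ≤ k * ∑[ i < k ] (f i * f i)
cauchy-schwarz {k} f = *-cancelˡ-≤ 2 (begin
  2 * (S * S)                                        ≡⟨ cong (2 *_) square ⟩
  2 * ∑[ i < k ] ∑[ j < k ] (f i * f j)              ≡⟨ double ⟩
  ∑[ i < k ] ∑[ j < k ] (2 * (f i * f j))            ≤⟨ ∑-mono (λ i → ∑-mono (λ j → 2ab≤a²+b² (f i) (f j))) ⟩
  ∑[ i < k ] ∑[ j < k ] (f i * f i + f j * f j)      ≡⟨ sum-cong-≗ (λ i → inner (f i * f i)) ⟩
  ∑[ i < k ] (k * (f i * f i) + Q)                   ≡⟨ ∑-distrib-+ (λ i → k * (f i * f i)) (λ _ → Q) ⟩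
  ∑[ i < k ] (k * (f i * f i)) + ∑[ i < k ] Q
                                    ≡⟨ cong₂ _+_ (sym (*-distribˡ-sum k (λ i → f i * f i))) (∑-const k Q) ⟩
  k * Q + k * Q                                      ≡⟨ cong (k * Q +_) (sym (+-identityʳ (k * Q))) ⟩
  2 * (k * Q)                                        ∎)
  where
  open ≤-Reasoning
  S Q : ℕ
  S = sum f
  Q = ∑[ i < k ] (f i * f i)
  square : S * S ≡ ∑[ i < k ] ∑[ j < k ] (f i * f j)
  square = trans (*-distribʳ-sum S f) (sum-cong-≗ (λ i → *-distribˡ-sum (f i) f))
  double : 2 * ∑[ i < k ] ∑[ j < k ] (f i * f j) ≡ ∑[ i < k ] ∑[ j < k ] (2 * (f i * f j))
  double = trans (*-distribˡ-sum 2 (λ i → ∑[ j < k ] (f i * f j)))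
                 (sum-cong-≗ (λ i → *-distribˡ-sum 2 (λ j → f i * f j)))
  inner : ∀ a → ∑[ j < k ] (a + f j * f j) ≡ k * a + Q
  inner a = trans (∑-distrib-+ (λ _ → a) (λ j → f j * f j)) (cong (_+ Q) (∑-const k a))

private
  variable
    ℓ₁ ℓ₂ : Level
    A : Set ℓ₁
    B : Set ℓ₂

𝟙 : Dec A → ℕ
𝟙 (yes _) = 1
𝟙 (no _) = 0

𝟙≤1 : (d : Dec A) → 𝟙 d ≤ 1
𝟙≤1 (yes _) = s≤s z≤n
𝟙≤1 (no _) = z≤n

𝟙-yes : (d : Dec A) → A → 𝟙 d ≡ 1
𝟙-yes (yes _) _ = refl
𝟙-yes (no ¬a) a = contradiction a ¬a

𝟙-sound : (d : Dec A) → 1 ≤ 𝟙 d → A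
𝟙-sound (yes a) _ = a

𝟙-mono : (d : Dec A) (e : Dec B) → (A → B) → 𝟙 d ≤ 𝟙 e
𝟙-mono (no _) _ _ = z≤n
𝟙-mono (yes a) e A→B = ≤-reflexive (sym (𝟙-yes e (A→B a)))

𝟙-map′ : ∀ {f : A → B} {g : B → A} (d : Dec A) → 𝟙 (map′ f g d) ≡ 𝟙 d
𝟙-map′ (yes _) = refl
𝟙-map′ (no _) = refl

δ δᶜ : ∀ {k} → Fin k → Fin k → ℕ
δ i j = 𝟙 (i ≟ j)
δᶜ i j = 𝟙 (¬? (i ≟ j))

δ+δᶜ≡1 : ∀ {k} (i j : Fin k) → δ i j + δᶜ i j ≡ 1
δ+δᶜ≡1 i j with i ≟ j
... | yes _ = refl
... | no _ = refl

δ-sym : ∀ {k} (i j : Fin k) → δ i j ≡ δ j i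
δ-sym i j = ≤-antisym (𝟙-mono (i ≟ j) (j ≟ i) sym) (𝟙-mono (j ≟ i) (i ≟ j) sym)

δᶜ-sym : ∀ {k} (i j : Fin k) → δᶜ i j ≡ δᶜ j i
δᶜ-sym i j = ≤-antisym (𝟙-mono (¬? (i ≟ j)) (¬? (j ≟ i)) (λ i≢j j≡i → i≢j (sym j≡i)))
                       (𝟙-mono (¬? (j ≟ i)) (¬? (i ≟ j)) (λ j≢i i≡j → j≢i (sym i≡j)))

∑-δ : ∀ {k} (i : Fin k) (g : Fin k → ℕ) → ∑[ j < k ] (δ i j * g j) ≡ g i
∑-δ {suc k} zero g = begin
  g zero + 0 + ∑[ j < k ] 0 ≡⟨ cong₂ _+_ (+-identityʳ (g zero)) (trans (∑-const k 0) (*-zeroʳ k)) ⟩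
  g zero + 0                ≡⟨ +-identityʳ (g zero) ⟩
  g zero                    ∎
  where open ≡-Reasoning
∑-δ {suc k} (suc i) g = trans (sum-cong-≗ shift) (∑-δ i (λ j → g (suc j)))
  where
  shift : ∀ j → δ (suc i) (suc j) * g (suc j) ≡ δ i j * g (suc j)
  shift j = cong (_* g (suc j)) (𝟙-map′ (i ≟ j))

*-≤1 : ∀ {a b} → a ≤ 1 → b ≤ 1 → a * b ≤ 1
*-≤1 a≤1 b≤1 = *-mono-≤ a≤1 b≤1

≤1-scale : ∀ {a} c → a ≤ 1 → a * c ≤ c
≤1-scale c a≤1 = ≤-trans (*-monoˡ-≤ c a≤1) (≤-reflexive (*-identityˡ c))

*-pos⁻ : ∀ a b → 1 ≤ a * b → 1 ≤ a × 1 ≤ b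
*-pos⁻ (suc a) zero pos = contradiction (subst (1 ≤_) (*-zeroʳ (suc a)) pos) (λ ())
*-pos⁻ (suc a) (suc b) _ = s≤s z≤n , s≤s z≤n

≤-𝟙 : ∀ {k} (d : Dec B) → k ≤ 1 → (1 ≤ k → B) → k ≤ 𝟙 d
≤-𝟙 {k = zero} _ _ _ = z≤n
≤-𝟙 {k = suc _} d k≤1 pos = ≤-trans k≤1 (≤-reflexive (sym (𝟙-yes d (pos (s≤s z≤n)))))

*-mono-pos : ∀ c {k b} → (1 ≤ c → k ≤ b) → c * k ≤ c * b
*-mono-pos zero _ = z≤n
*-mono-pos (suc c) k≤b = *-monoʳ-≤ (suc c) (k≤b (s≤s z≤n))

-- Summing f over the image of an injection ι is at most summing f over
-- everything: each index is hit at most once.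
∑-injection : ∀ {ℓ k} (ι : Fin ℓ → Fin k) → Injective _≡_ _≡_ ι → (f : Fin k → ℕ) →
              ∑[ s < ℓ ] f (ι s) ≤ sum f
∑-injection {ℓ} {k} ι ι-inj f = begin
  ∑[ s < ℓ ] f (ι s)                              ≡⟨ sum-cong-≗ (λ s → sym (∑-δ (ι s) f)) ⟩
  ∑[ s < ℓ ] ∑[ y < k ] (δ (ι s) y * f y)          ≡⟨ ∑-comm (λ s y → δ (ι s) y * f y) ⟩
  ∑[ y < k ] ∑[ s < ℓ ] (δ (ι s) y * f y)
                                  ≡⟨ sum-cong-≗ (λ y → sym (*-distribʳ-sum (f y) (λ s → δ (ι s) y))) ⟩
  ∑[ y < k ] (∑[ s < ℓ ] δ (ι s) y * f y)          ≤⟨ ∑-mono (λ y → *-monoˡ-≤ (f y) (hits≤1 y)) ⟩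
  ∑[ y < k ] (1 * f y)                            ≡⟨ sum-cong-≗ (λ y → *-identityˡ (f y)) ⟩
  sum f                                           ∎
  where
  open ≤-Reasoning
  hits≤1 : ∀ y → ∑[ s < ℓ ] δ (ι s) y ≤ 1
  hits≤1 y = ∑-≤1 (λ s → δ (ι s) y) (λ s → 𝟙≤1 (ι s ≟ y))
               (λ p q → ι-inj (trans (𝟙-sound (_ ≟ y) p) (sym (𝟙-sound (_ ≟ y) q))))

injective-from-< : ∀ {ℓ} {B : Set} (f : Fin ℓ → B) →
                   (∀ {k l} → k Fin.< l → f k ≢ f l) → Injective _≡_ _≡_ f
injective-from-< f separates {k} {l} eq with FinP.<-cmp k l
... | tri< k<l _ _ = contradiction eq (separates k<l)
... | tri≈ _ k≡l _ = k≡l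
... | tri> _ _ l<k = contradiction (sym eq) (separates l<k)

AllPairs-lookup : ∀ {A : Set} {R : A → A → Set} {xs : List A} → AllPairs R xs →
                  ∀ {i j} → i Fin.< j → R (lookup xs i) (lookup xs j)
AllPairs-lookup (Rx ∷ _) {zero} {suc j} _ = All.lookup Rx (∈-lookup j)
AllPairs-lookup (_ ∷ R-xs) {suc i} {suc j} (s≤s i<j) = AllPairs-lookup R-xs i<j

module Greedy {N : ℕ} {P : Fin N → Set} (P? : ∀ x → Dec (P x))
              {_~_ : Fin N → Fin N → Set} (_~?_ : ∀ x y → Dec (x ~ y))
              (~-refl : ∀ {x} → x ~ x) (~-sym : ∀ {x y} → x ~ y → y ~ x) where

  keep : List (Fin N) → List (Fin N)
  keep [] = []
  keep (x ∷ xs) with P? x | Any.any? (_~? x) (keep xs)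
  ... | yes _ | no _ = x ∷ keep xs
  ... | _     | _    = keep xs

  keep⊆P : ∀ xs → All P (keep xs)
  keep⊆P [] = []
  keep⊆P (x ∷ xs) with P? x | Any.any? (_~? x) (keep xs)
  ... | yes px | no _  = px ∷ keep⊆P xs
  ... | yes _  | yes _ = keep⊆P xs
  ... | no _   | _     = keep⊆P xs

  keep-independent : ∀ xs → AllPairs (λ g h → ¬ g ~ h) (keep xs)
  keep-independent [] = []
  keep-independent (x ∷ xs) with P? x | Any.any? (_~? x) (keep xs)
  ... | yes _ | no free = All.map (λ ¬g~x x~g → ¬g~x (~-sym x~g)) (¬Any⇒All¬ _ free)
                          ∷ keep-independent xs
  ... | yes _ | yes _ = keep-independent xs
  ... | no _  | _     = keep-independent xs

  keep-dominating : ∀ xs {y} → y ∈ₗ xs → P y → Any (_~ y) (keep xs)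
  keep-dominating (x ∷ xs) y∈ Py with P? x | Any.any? (_~? x) (keep xs) | y∈
  ... | yes _  | no _        | here refl  = here ~-refl
  ... | yes _  | no _        | there y∈xs = there (keep-dominating xs y∈xs Py)
  ... | yes _  | yes clash   | here refl  = clash
  ... | yes _  | yes _       | there y∈xs = keep-dominating xs y∈xs Py
  ... | no ¬Px | _           | here refl  = contradiction Py ¬Px
  ... | no _   | _           | there y∈xs = keep-dominating xs y∈xs Py

  record MaximalIndependent : Set where
    field
      size        : ℕ
      member      : Fin size → Fin N
      member∈P    : ∀ s → P (member s)
      independent : ∀ {s s′} → s Fin.< s′ → ¬ member s ~ member s′
      dominating  : ∀ {x} → P x → ∃[ s ] member s ~ x

    -- Conflicts are reflexive, so members are distinct.
    member-injective : Injective _≡_ _≡_ member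
    member-injective = injective-from-<
      member (λ s<s′ eq → independent s<s′ (subst (member _ ~_) eq ~-refl))

    covering : ∑[ x < N ] 𝟙 (P? x) ≤ ∑[ s < size ] ∑[ x < N ] (𝟙 (P? x) * 𝟙 (member s ~? x))
    covering = begin
      ∑[ x < N ] 𝟙 (P? x)                                  ≤⟨ ∑-mono counted ⟩
      ∑[ x < N ] ∑[ s < size ] (𝟙 (P? x) * 𝟙 (member s ~? x)) ≡⟨ ∑-comm (λ x s → 𝟙 (P? x) * 𝟙 (member s ~? x)) ⟩
      ∑[ s < size ] ∑[ x < N ] (𝟙 (P? x) * 𝟙 (member s ~? x)) ∎
      where
      open ≤-Reasoning
      counted : ∀ x → 𝟙 (P? x) ≤ ∑[ s < size ] (𝟙 (P? x) * 𝟙 (member s ~? x))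
      counted x with P? x
      ... | no _ = z≤n
      ... | yes Px with dominating Px
      ...   | s , s~x = ≤-trans (≤-reflexive (sym (trans (*-identityˡ _) (𝟙-yes (member s ~? x) s~x))))
                                (term≤∑ (λ s′ → 1 * 𝟙 (member s′ ~? x)) s)

  maximalIndependent : MaximalIndependent
  maximalIndependent = record
    { size        = length G
    ; member      = lookup G
    ; member∈P    = λ s → All.lookup (keep⊆P (allFin N)) (∈-lookup s)
    ; independent = AllPairs-lookup (keep-independent (allFin N))
    ; dominating  = λ {x} Px → let d = keep-dominating (allFin N) (∈-allFin x) Px
                               in Any.index d , lookup-index d
    }
    where
    G : List (Fin N)
    G = keep (allFin N)

module Geometry {n r : ℕ} (H : Hypergraph n r) where
  open Hypergraph H

  Adjacent : Fin n → Fin n → Set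
  Adjacent x y = ∃[ e ] (x ∈ edge e × y ∈ edge e)

  Collinear : Fin n → Fin n → Fin n → Set
  Collinear x y z = ∃[ e ] (x ∈ edge e × y ∈ edge e × z ∈ edge e)

  adjacent? : ∀ x y → Dec (Adjacent x y)
  adjacent? x y = FinP.any? (λ e → x ∈? edge e ×-dec y ∈? edge e)

  collinear? : ∀ x y z → Dec (Collinear x y z)
  collinear? x y z = FinP.any? (λ e → x ∈? edge e ×-dec y ∈? edge e ×-dec z ∈? edge e)

  Linear : Set
  Linear = ∀ {x y e f} → x ≢ y → x ∈ edge e → y ∈ edge e → x ∈ edge f → y ∈ edge f → e ≡ f

  -- Two distinct hyperedges through two distinct vertices form a Berge-C₂.
  C₂-free⇒linear : ¬ ContainsBerge H C₂ → Linear
  C₂-free⇒linear C₂-free {x} {y} {e} {f} x≢y x∈e y∈e x∈f y∈f with e ≟ f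
  ... | yes e≡f = e≡f
  ... | no e≢f = ⊥-elim (C₂-free (place , place-injective , label , label-injective , contains))
    where
    place : Fin 2 → Fin n
    place zero = x
    place (suc zero) = y
    label : Fin 2 → Fin m
    label zero = e
    label (suc zero) = f
    place-injective : Injective _≡_ _≡_ place
    place-injective {zero} {zero} _ = refl
    place-injective {zero} {suc zero} eq = contradiction eq x≢y
    place-injective {suc zero} {zero} eq = contradiction (sym eq) x≢y
    place-injective {suc zero} {suc zero} _ = refl
    label-injective : Injective _≡_ _≡_ label
    label-injective {zero} {zero} _ = refl
    label-injective {zero} {suc zero} eq = contradiction eq e≢f
    label-injective {suc zero} {zero} eq = contradiction (sym eq) e≢f
    label-injective {suc zero} {suc zero} _ = refl
    contains : ∀ i → (place (proj₁ (lookup (Graph.edges C₂) i)) ∈ edge (label i))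
                   × (place (proj₂ (lookup (Graph.edges C₂) i)) ∈ edge (label i))
    contains zero = x∈e , y∈e
    contains (suc zero) = x∈f , y∈f

  berge-by-labelling : (F : Graph) (place : Fin (Graph.k F) → Fin n) → Injective _≡_ _≡_ place →
    (label : Fin (Graph.k F) × Fin (Graph.k F) → Fin m) →
    All (λ uv → place (proj₁ uv) ∈ edge (label uv) × place (proj₂ uv) ∈ edge (label uv)) (Graph.edges F) →
    AllPairs (λ uv u′v′ → label uv ≢ label u′v′) (Graph.edges F) →
    ContainsBerge H F
  berge-by-labelling F place place-injective label contains distinct =
    place , place-injective ,
    (λ i → label (lookup (Graph.edges F) i)) , injective-from-< _ (AllPairs-lookup distinct) ,
    (λ i → All.lookup contains (∈-lookup i))

  record Spoke (a b x : Fin n) : Set where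
    constructor spoke
    field
      a≢x           : a ≢ x
      b≢x           : b ≢ x
      via-a         : Adjacent a x
      via-b         : Adjacent b x
      non-collinear : ¬ Collinear a b x

  spoke? : ∀ a b x → Dec (Spoke a b x)
  spoke? a b x = map′ (λ (p , q , u , v , w) → spoke p q u v w)
                      (λ (spoke p q u v w) → p , q , u , v , w)
                      (¬? (a ≟ x) ×-dec ¬? (b ≟ x) ×-dec adjacent? a x ×-dec adjacent? b x
                         ×-dec ¬? (collinear? a b x))

  -- Two spokes between a and b conflict when they cannot be used together in a
  -- Berge-K_{2,t}: they coincide, or share a hyperedge through a or through b.
  Conflict : (a b : Fin n) → Fin n → Fin n → Set
  Conflict a b x y = x ≡ y ⊎ Collinear a x y ⊎ Collinear b x y

  conflict? : ∀ a b x y → Dec (Conflict a b x y)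
  conflict? a b x y = x ≟ y ⊎-dec collinear? a x y ⊎-dec collinear? b x y

  conflict-sym : ∀ {a b x y} → Conflict a b x y → Conflict a b y x
  conflict-sym (inj₁ x≡y) = inj₁ (sym x≡y)
  conflict-sym (inj₂ (inj₁ (e , a∈e , x∈e , y∈e))) = inj₂ (inj₁ (e , a∈e , y∈e , x∈e))
  conflict-sym (inj₂ (inj₂ (e , b∈e , x∈e , y∈e))) = inj₂ (inj₂ (e , b∈e , y∈e , x∈e))

  -- t = suc s pairwise non-conflicting spokes x₀, …, x_s between a and b form a
  -- Berge-K_{2,t}: spoke k uses hyperedges hₖ ∋ a, xₖ and gₖ ∋ b, xₖ.  The hₖ
  -- (resp. gₖ) are distinct since no two spokes share a hyperedge through a
  -- (resp. b), and hₖ = gₗ would put a, b and xₖ in one hyperedge.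
  berge-K₂ : ∀ {s a b} (x : Fin (suc s) → Fin n) → (∀ k → Spoke a b (x k)) →
             (∀ {k l} → k Fin.< l → ¬ Conflict a b (x k) (x l)) → ContainsBerge H (K₂ (suc s))
  berge-K₂ {s} {a} {b} x spokes free =
    berge-by-labelling (K₂ (suc s)) place place-injective label
      (AllP.++⁺ (AllP.map⁺ (AllP.tabulate⁺ (λ k → a∈h k , x∈h k)))
                (AllP.map⁺ (AllP.tabulate⁺ (λ k → b∈g k , x∈g k))))
      (APP.++⁺ (APP.map⁺ (APP.tabulate⁺-< h-distinct)) (APP.map⁺ (APP.tabulate⁺-< g-distinct))
               (AllP.map⁺ (AllP.tabulate⁺ (λ k → AllP.map⁺ (AllP.tabulate⁺ (λ l → h≢g k l))))))
    where
    open Spoke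
    h g : Fin (suc s) → Fin m
    h k = proj₁ (via-a (spokes k))
    g k = proj₁ (via-b (spokes k))
    a∈h : ∀ k → a ∈ edge (h k)
    a∈h k = proj₁ (proj₂ (via-a (spokes k)))
    x∈h : ∀ k → x k ∈ edge (h k)
    x∈h k = proj₂ (proj₂ (via-a (spokes k)))
    b∈g : ∀ k → b ∈ edge (g k)
    b∈g k = proj₁ (proj₂ (via-b (spokes k)))
    x∈g : ∀ k → x k ∈ edge (g k)
    x∈g k = proj₂ (proj₂ (via-b (spokes k)))

    h-distinct : ∀ {k l} → k Fin.< l → h k ≢ h l
    h-distinct {k} {l} k<l hk≡hl =
      free k<l (inj₂ (inj₁ (h k , a∈h k , x∈h k , subst (λ e → x l ∈ edge e) (sym hk≡hl) (x∈h l))))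
    g-distinct : ∀ {k l} → k Fin.< l → g k ≢ g l
    g-distinct {k} {l} k<l gk≡gl =
      free k<l (inj₂ (inj₂ (g k , b∈g k , x∈g k , subst (λ e → x l ∈ edge e) (sym gk≡gl) (x∈g l))))
    h≢g : ∀ k l → h k ≢ g l
    h≢g k l hk≡gl =
      non-collinear (spokes k) (h k , a∈h k , subst (λ e → b ∈ edge e) (sym hk≡gl) (b∈g l) , x∈h k)

    -- The centres differ, as a spoke is never collinear with them.
    a≢b : a ≢ b
    a≢b refl = non-collinear (spokes zero) (h zero , a∈h zero , a∈h zero , x∈h zero)
    x-injective : Injective _≡_ _≡_ x
    x-injective = injective-from-< x (λ k<l xk≡xl → free k<l (inj₁ xk≡xl))

    place : Fin (2 + suc s) → Fin n
    place zero = a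
    place (suc zero) = b
    place (suc (suc k)) = x k
    place-injective : Injective _≡_ _≡_ place
    place-injective {zero} {zero} _ = refl
    place-injective {zero} {suc zero} eq = contradiction eq a≢b
    place-injective {zero} {suc (suc k)} eq = contradiction eq (a≢x (spokes k))
    place-injective {suc zero} {zero} eq = contradiction (sym eq) a≢b
    place-injective {suc zero} {suc zero} _ = refl
    place-injective {suc zero} {suc (suc k)} eq = contradiction eq (b≢x (spokes k))
    place-injective {suc (suc k)} {zero} eq = contradiction (sym eq) (a≢x (spokes k))
    place-injective {suc (suc k)} {suc zero} eq = contradiction (sym eq) (b≢x (spokes k))
    place-injective {suc (suc k)} {suc (suc l)} eq = cong (λ i → suc (suc i)) (x-injective eq)

    -- The edge {0, 2+k} of K_{2,t} is carried by hₖ, the edge {1, 2+k} by gₖ;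
    -- other pairs are not edges of K_{2,t}, so their label is irrelevant.
    label : Fin (2 + suc s) × Fin (2 + suc s) → Fin m
    label (zero , suc (suc k)) = h k
    label (suc zero , suc (suc k)) = g k
    label _ = h zero

∣p∣≡∑ : ∀ {k} (p : Subset k) → ∣ p ∣ ≡ ∑[ x < k ] 𝟙 (x ∈? p)
∣p∣≡∑ [] = refl
∣p∣≡∑ (inside ∷ p) = cong suc (trans (∣p∣≡∑ p) (sum-cong-≗ (λ x → sym (𝟙-map′ (x ∈? p)))))
∣p∣≡∑ (outside ∷ p) = trans (∣p∣≡∑ p) (sum-cong-≗ (λ x → sym (𝟙-map′ (x ∈? p))))

module Incidences {n r : ℕ} (H : Hypergraph n r) where
  open Hypergraph H
  open Geometry H

  mem : Fin n → Fin m → ℕ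
  mem x e = 𝟙 (x ∈? edge e)

  mem≤1 : ∀ x e → mem x e ≤ 1
  mem≤1 x e = 𝟙≤1 (x ∈? edge e)

  mem-pos : ∀ x e → 1 ≤ mem x e → x ∈ edge e
  mem-pos x e = 𝟙-sound (x ∈? edge e)

  deg : Fin n → ℕ
  deg x = ∑[ e < m ] mem x e

  common : Fin n → Fin n → ℕ
  common x y = ∑[ e < m ] (mem x e * mem y e)

  common₃ : Fin n → Fin n → Fin n → ℕ
  common₃ x y z = ∑[ e < m ] (mem x e * mem y e * mem z e)

  edge-size : ∀ e → ∑[ x < n ] mem x e ≡ r
  edge-size e = trans (sym (∣p∣≡∑ (edge e))) (uniform e)

  ∑-through : (w : Fin m → ℕ) → ∑[ z < n ] ∑[ e < m ] (w e * mem z e) ≡ r * sum w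
  ∑-through w = begin
    ∑[ z < n ] ∑[ e < m ] (w e * mem z e)  ≡⟨ ∑-comm (λ z e → w e * mem z e) ⟩
    ∑[ e < m ] ∑[ z < n ] (w e * mem z e)  ≡⟨ sum-cong-≗ (λ e → sym (*-distribˡ-sum (w e) (λ z → mem z e))) ⟩
    ∑[ e < m ] (w e * ∑[ z < n ] mem z e)  ≡⟨ sum-cong-≗ (λ e → trans (cong (w e *_) (edge-size e)) (*-comm (w e) r)) ⟩
    ∑[ e < m ] (r * w e)                   ≡⟨ *-distribˡ-sum r w ⟨
    r * sum w                              ∎
    where open ≡-Reasoning

  handshake : ∑[ x < n ] deg x ≡ r * m
  handshake = begin
    ∑[ x < n ] deg x                       ≡⟨ sum-cong-≗ (λ x → sum-cong-≗ (λ e → sym (*-identityˡ (mem x e)))) ⟩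
    ∑[ x < n ] ∑[ e < m ] (1 * mem x e)    ≡⟨ ∑-through (λ _ → 1) ⟩
    r * ∑[ e < m ] 1                       ≡⟨ cong (r *_) (trans (∑-const m 1) (*-identityʳ m)) ⟩
    r * m                                  ∎
    where open ≡-Reasoning

  ∑-common : ∀ x → ∑[ y < n ] common x y ≡ r * deg x
  ∑-common x = ∑-through (mem x)

  ∑-common₃ : ∀ x y → ∑[ z < n ] common₃ x y z ≡ r * common x y
  ∑-common₃ x y = ∑-through (λ e → mem x e * mem y e)

  -- Each hyperedge contributes r³ ordered triples of its vertices.
  triples : ∑[ x < n ] ∑[ y < n ] ∑[ z < n ] common₃ x y z ≡ r * r * r * m
  triples = begin
    ∑[ x < n ] ∑[ y < n ] ∑[ z < n ] common₃ x y z  ≡⟨ sum-cong-≗ (λ x → sum-cong-≗ (∑-common₃ x)) ⟩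
    ∑[ x < n ] ∑[ y < n ] (r * common x y)         ≡⟨ sum-cong-≗ (λ x → sym (*-distribˡ-sum r (common x))) ⟩
    ∑[ x < n ] (r * ∑[ y < n ] common x y)         ≡⟨ sum-cong-≗ (λ x → cong (r *_) (∑-common x)) ⟩
    ∑[ x < n ] (r * (r * deg x))                   ≡⟨ *-distribˡ-sum r (λ x → r * deg x) ⟨
    r * ∑[ x < n ] (r * deg x)                     ≡⟨ cong (r *_) (trans (sym (*-distribˡ-sum r deg)) (cong (r *_) handshake)) ⟩
    r * (r * (r * m))                              ≡⟨ reassociate r m ⟩
    r * r * r * m                                  ∎
    where
    open ≡-Reasoning
    reassociate : ∀ r m → r * (r * (r * m)) ≡ r * r * r * m
    reassociate = solve-∀

  pairs : Fin n → ℕ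
  pairs v = ∑[ e < m ] ∑[ f < m ] (δᶜ e f * (mem v e * mem v f))

  -- deg(v)² counts all ordered pairs of hyperedges through v, equal or not.
  deg² : ∀ v → deg v * deg v ≡ pairs v + deg v
  deg² v = begin
    deg v * deg v                                               ≡⟨ ∑-product (mem v) (mem v) ⟩
    ∑[ e < m ] ∑[ f < m ] p e f                                 ≡⟨ sum-cong-≗ (λ e → sum-cong-≗ (split e)) ⟩
    ∑[ e < m ] ∑[ f < m ] (δᶜ e f * p e f + δ e f * p e f)
      ≡⟨ sum-cong-≗ (λ e → ∑-distrib-+ (λ f → δᶜ e f * p e f) (λ f → δ e f * p e f)) ⟩
    ∑[ e < m ] (∑[ f < m ] (δᶜ e f * p e f) + ∑[ f < m ] (δ e f * p e f))
      ≡⟨ ∑-distrib-+ (λ e → ∑[ f < m ] (δᶜ e f * p e f)) (λ e → ∑[ f < m ] (δ e f * p e f)) ⟩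
    pairs v + ∑[ e < m ] ∑[ f < m ] (δ e f * p e f)             ≡⟨ cong (pairs v +_) (sum-cong-≗ diagonal) ⟩
    pairs v + deg v                                             ∎
    where
    open ≡-Reasoning
    p : Fin m → Fin m → ℕ
    p e f = mem v e * mem v f
    split : ∀ e f → p e f ≡ δᶜ e f * p e f + δ e f * p e f
    split e f = begin
      p e f                             ≡⟨ *-identityˡ (p e f) ⟨
      1 * p e f                         ≡⟨ cong (_* p e f) (trans (sym (δ+δᶜ≡1 e f)) (+-comm (δ e f) (δᶜ e f))) ⟩
      (δᶜ e f + δ e f) * p e f          ≡⟨ *-distribʳ-+ (p e f) (δᶜ e f) (δ e f) ⟩
      δᶜ e f * p e f + δ e f * p e f    ∎
    idempotent : ∀ e → mem v e * mem v e ≡ mem v e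
    idempotent e with v ∈? edge e
    ... | yes _ = refl
    ... | no _ = refl
    diagonal : ∀ e → ∑[ f < m ] (δ e f * p e f) ≡ mem v e
    diagonal e = trans (∑-δ e (p e)) (idempotent e)

  ∑-deg² : ∑[ v < n ] (deg v * deg v) ≡ ∑[ v < n ] pairs v + r * m
  ∑-deg² = trans (sum-cong-≗ deg²) (trans (∑-distrib-+ pairs deg) (cong (∑[ v < n ] pairs v +_) handshake))

  collinear⇒common₃ : ∀ {x y z} → Collinear x y z → 1 ≤ common₃ x y z
  collinear⇒common₃ {x} {y} {z} (e , x∈e , y∈e , z∈e) =
    subst (_≤ common₃ x y z) incident (term≤∑ (λ e′ → mem x e′ * mem y e′ * mem z e′) e)
    where
    incident : mem x e * mem y e * mem z e ≡ 1
    incident rewrite 𝟙-yes (x ∈? edge e) x∈e | 𝟙-yes (y ∈? edge e) y∈e | 𝟙-yes (z ∈? edge e) z∈e = refl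

  common₃⇒collinear : ∀ {x y z} → 1 ≤ common₃ x y z → Collinear x y z
  common₃⇒collinear {x} {y} {z} pos with ∑-pos _ pos
  ... | e , pos-e with *-pos⁻ (mem x e * mem y e) (mem z e) pos-e
  ...   | pos-xy , z∈e with *-pos⁻ (mem x e) (mem y e) pos-xy
  ...     | x∈e , y∈e = e , mem-pos x e x∈e , mem-pos y e y∈e , mem-pos z e z∈e

  conflict-count : ∀ a b g x → 𝟙 (conflict? a b g x) ≤ δ g x + δᶜ g x * (common₃ a g x + common₃ b g x)
  conflict-count a b g x = by-cases (g ≟ x) (conflict? a b g x)
    where
    by-cases : (same : Dec (g ≡ x)) (conflict : Dec (Conflict a b g x)) →
               𝟙 conflict ≤ 𝟙 same + 𝟙 (¬? same) * (common₃ a g x + common₃ b g x)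
    by-cases (yes _) conflict = ≤-trans (𝟙≤1 conflict) (m≤m+n 1 _)
    by-cases (no _) (no _) = z≤n
    by-cases (no g≢x) (yes (inj₁ g≡x)) = contradiction g≡x g≢x
    by-cases (no _) (yes (inj₂ (inj₁ col))) =
      ≤-trans (collinear⇒common₃ col) (≤-trans (m≤m+n _ _) (≤-reflexive (sym (+-identityʳ _))))
    by-cases (no _) (yes (inj₂ (inj₂ col))) =
      ≤-trans (collinear⇒common₃ col) (≤-trans (m≤n+m _ _) (≤-reflexive (sym (+-identityʳ _))))

module Cherries {n r : ℕ} (H : Hypergraph n r) (linear : Geometry.Linear H) where
  open Hypergraph H
  open Geometry H
  open Incidences H

  common≤1 : ∀ {x y} → x ≢ y → common x y ≤ 1
  common≤1 {x} {y} x≢y = ∑-≤1 (λ e → mem x e * mem y e) (λ e → *-≤1 (mem≤1 x e) (mem≤1 y e)) unique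
    where
    unique : ∀ {e f} → 1 ≤ mem x e * mem y e → 1 ≤ mem x f * mem y f → e ≡ f
    unique {e} {f} pe pf with *-pos⁻ (mem x e) _ pe | *-pos⁻ (mem x f) _ pf
    ... | x∈e , y∈e | x∈f , y∈f = linear x≢y (mem-pos x e x∈e) (mem-pos y e y∈e) (mem-pos x f x∈f) (mem-pos y f y∈f)

  arm : Fin n → Fin n → Fin m → ℕ
  arm u v e = mem v e * (mem u e * δᶜ u v)

  arm≤1 : ∀ u v e → arm u v e ≤ 1
  arm≤1 u v e = *-≤1 (mem≤1 v e) (*-≤1 (mem≤1 u e) (𝟙≤1 (¬? (u ≟ v))))

  arm-pos : ∀ u v e → 1 ≤ arm u v e → u ∈ edge e × v ∈ edge e × u ≢ v
  arm-pos u v e pos with *-pos⁻ (mem v e) _ pos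
  ... | v∈e , rest with *-pos⁻ (mem u e) _ rest
  ...   | u∈e , u≢v = mem-pos u e u∈e , mem-pos v e v∈e , 𝟙-sound (¬? (u ≟ v)) u≢v

  ∑-arm≤1 : ∀ u v → ∑[ e < m ] arm u v e ≤ 1
  ∑-arm≤1 u v = ∑-≤1 (arm u v) (arm≤1 u v) unique
    where
    unique : ∀ {e f} → 1 ≤ arm u v e → 1 ≤ arm u v f → e ≡ f
    unique {e} {f} pe pf with arm-pos u v e pe | arm-pos u v f pf
    ... | u∈e , v∈e , u≢v | u∈f , v∈f , _ = linear u≢v u∈e v∈e u∈f v∈f

  ∑-arm : ∀ v e → ∑[ u < n ] arm u v e ≡ mem v e * (r ∸ 1)
  ∑-arm v e = trans (sym (*-distribˡ-sum (mem v e) (λ u → mem u e * δᶜ u v))) (by-cases (v ∈? edge e))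
    where
    others : v ∈ edge e → ∑[ u < n ] (mem u e * δᶜ u v) ≡ r ∸ 1
    others v∈e = begin
      ∑[ u < n ] (mem u e * δᶜ u v)                           ≡⟨ m+n∸n≡m _ 1 ⟨
      ∑[ u < n ] (mem u e * δᶜ u v) + 1 ∸ 1
        ≡⟨ cong (λ k → ∑[ u < n ] (mem u e * δᶜ u v) + k ∸ 1)
                (trans (sym (𝟙-yes (v ∈? edge e) v∈e)) (sym (∑-δ v (λ u → mem u e)))) ⟩
      ∑[ u < n ] (mem u e * δᶜ u v) + ∑[ u < n ] (δ v u * mem u e) ∸ 1
        ≡⟨ cong (_∸ 1) (sym (∑-distrib-+ (λ u → mem u e * δᶜ u v) (λ u → δ v u * mem u e))) ⟩
      ∑[ u < n ] (mem u e * δᶜ u v + δ v u * mem u e) ∸ 1     ≡⟨ cong (_∸ 1) (sum-cong-≗ split) ⟩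
      ∑[ u < n ] mem u e ∸ 1                                  ≡⟨ cong (_∸ 1) (edge-size e) ⟩
      r ∸ 1                                                   ∎
      where
      open ≡-Reasoning
      split : ∀ u → mem u e * δᶜ u v + δ v u * mem u e ≡ mem u e
      split u = begin
        mem u e * δᶜ u v + δ v u * mem u e  ≡⟨ cong (λ d → mem u e * δᶜ u v + d * mem u e) (δ-sym v u) ⟩
        mem u e * δᶜ u v + δ u v * mem u e  ≡⟨ cong (mem u e * δᶜ u v +_) (*-comm (δ u v) (mem u e)) ⟩
        mem u e * δᶜ u v + mem u e * δ u v  ≡⟨ *-distribˡ-+ (mem u e) (δᶜ u v) (δ u v) ⟨
        mem u e * (δᶜ u v + δ u v)          ≡⟨ cong (mem u e *_) (trans (+-comm (δᶜ u v) (δ u v)) (δ+δᶜ≡1 u v)) ⟩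
        mem u e * 1                         ≡⟨ *-identityʳ (mem u e) ⟩
        mem u e                             ∎
    by-cases : (d : Dec (v ∈ edge e)) → 𝟙 d * ∑[ u < n ] (mem u e * δᶜ u v) ≡ 𝟙 d * (r ∸ 1)
    by-cases (yes v∈e) = cong (1 *_) (others v∈e)
    by-cases (no _) = refl

  cherries : Fin n → Fin n → Fin n → ℕ
  cherries u v w = ∑[ e < m ] ∑[ f < m ] (δᶜ e f * (arm u v e * arm w v f))

  cherries≤1 : ∀ u v w → cherries u v w ≤ 1
  cherries≤1 u v w = begin
    cherries u v w
      ≤⟨ ∑-mono (λ e → ∑-mono (λ f → ≤1-scale (arm u v e * arm w v f) (𝟙≤1 (¬? (e ≟ f))))) ⟩
    ∑[ e < m ] ∑[ f < m ] (arm u v e * arm w v f)     ≡⟨ ∑-product (arm u v) (arm w v) ⟨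
    ∑[ e < m ] arm u v e * ∑[ f < m ] arm w v f       ≤⟨ *-≤1 (∑-arm≤1 u v) (∑-arm≤1 w v) ⟩
    1                                                 ∎
    where open ≤-Reasoning

  cherries-sym : ∀ u v w → cherries u v w ≡ cherries w v u
  cherries-sym u v w = begin
    ∑[ e < m ] ∑[ f < m ] (δᶜ e f * (arm u v e * arm w v f))  ≡⟨ ∑-comm (λ e f → δᶜ e f * (arm u v e * arm w v f)) ⟩
    ∑[ f < m ] ∑[ e < m ] (δᶜ e f * (arm u v e * arm w v f))  ≡⟨ sum-cong-≗ (λ f → sum-cong-≗ (λ e → swap e f)) ⟩
    ∑[ f < m ] ∑[ e < m ] (δᶜ f e * (arm w v f * arm u v e))  ∎
    where
    open ≡-Reasoning
    swap : ∀ e f → δᶜ e f * (arm u v e * arm w v f) ≡ δᶜ f e * (arm w v f * arm u v e)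
    swap e f = cong₂ _*_ (δᶜ-sym e f) (*-comm (arm u v e) (arm w v f))

  Middle : Fin n → Fin n → Fin n → Set
  Middle u w v = 1 ≤ cherries u v w

  middle? : ∀ u w v → Dec (Middle u w v)
  middle? u w v = 1 ≤? cherries u v w

  middle-sym : ∀ u w v → 𝟙 (middle? u w v) ≡ 𝟙 (middle? w u v)
  middle-sym u w v = cong (λ c → 𝟙 (1 ≤? c)) (cherries-sym u v w)

  cherries≤middle : ∀ u v w → cherries u v w ≤ 𝟙 (middle? u w v)
  cherries≤middle u v w = ≤-𝟙 (middle? u w v) (cherries≤1 u v w) (λ pos → pos)

  record Cherry (u v w : Fin n) : Set where
    field
      e f  : Fin m
      e≢f  : e ≢ f
      u∈e  : u ∈ edge e
      v∈e  : v ∈ edge e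
      v∈f  : v ∈ edge f
      w∈f  : w ∈ edge f
      u≢v  : u ≢ v
      w≢v  : w ≢ v

  cherry : ∀ u w v → Middle u w v → Cherry u v w
  cherry u w v middle with ∑-pos _ middle
  ... | e , pos-e with ∑-pos _ pos-e
  ...   | f , pos with *-pos⁻ (δᶜ e f) _ pos
  ...     | e≢f , arms with *-pos⁻ (arm u v e) (arm w v f) arms
  ...       | arm-e , arm-f with arm-pos u v e arm-e | arm-pos w v f arm-f
  ...         | u∈e , v∈e , u≢v | w∈f , v∈f , w≢v = record
    { e = e ; f = f ; e≢f = 𝟙-sound (¬? (e ≟ f)) e≢f
    ; u∈e = u∈e ; v∈e = v∈e ; v∈f = v∈f ; w∈f = w∈f ; u≢v = u≢v ; w≢v = w≢v }

  -- No hyperedge contains u, w and a middle vertex v of a path u – v – w: it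
  -- would be both hyperedges of the path.  So middle vertices are spokes.
  middle⇒spoke : ∀ {u w v} → Middle u w v → Spoke u w v
  middle⇒spoke {u} {w} {v} middle = record
    { a≢x = u≢v ; b≢x = w≢v ; via-a = e , u∈e , v∈e ; via-b = f , w∈f , v∈f
    ; non-collinear = λ (g , u∈g , w∈g , v∈g) →
        e≢f (trans (linear u≢v u∈e v∈e u∈g v∈g) (sym (linear w≢v w∈f v∈f w∈g v∈g))) }
    where open Cherry (cherry u w v middle)

  -- If u, g, x are collinear with g ≠ x, then every w having both g and x as
  -- middle vertices with u is a spoke between g and x: it cannot lie on the
  -- hyperedge through g and x, which is also the one joining u to g.
  middles⇒spoke : ∀ {u g x w} → Collinear u g x → g ≢ x → Middle u w g → Middle u w x → Spoke g x w
  middles⇒spoke {u} {g} {x} {w} (c , u∈c , g∈c , x∈c) g≢x middle-g middle-x = record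
    { a≢x = λ g≡w → C.w≢v (sym g≡w) ; b≢x = λ x≡w → D.w≢v (sym x≡w)
    ; via-a = C.f , C.v∈f , C.w∈f ; via-b = D.f , D.v∈f , D.w∈f
    ; non-collinear = λ (h , g∈h , x∈h , w∈h) →
        let w∈c = subst (λ k → w ∈ edge k) (linear g≢x g∈h x∈h g∈c x∈c) w∈h
        in C.e≢f (trans (linear C.u≢v C.u∈e C.v∈e u∈c g∈c)
                        (sym (linear (λ g≡w → C.w≢v (sym g≡w)) C.v∈f C.w∈f g∈c w∈c))) }
    where
    module C = Cherry (cherry u w g middle-g)
    module D = Cherry (cherry u w x middle-x)

  -- Each ordered pair of distinct hyperedges through v carries (r - 1)² paths u – v – w.
  ∑-cherries : ∀ v → ∑[ u < n ] ∑[ w < n ] cherries u v w ≡ (r ∸ 1) * (r ∸ 1) * pairs v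
  ∑-cherries v = begin
    ∑[ u < n ] ∑[ w < n ] ∑[ e < m ] ∑[ f < m ] T u w e f  ≡⟨ sum-cong-≗ (λ u → ∑-comm₃ (T u)) ⟩
    ∑[ u < n ] ∑[ e < m ] ∑[ f < m ] ∑[ w < n ] T u w e f  ≡⟨ ∑-comm₃ (λ u e f → ∑[ w < n ] T u w e f) ⟩
    ∑[ e < m ] ∑[ f < m ] ∑[ u < n ] ∑[ w < n ] T u w e f  ≡⟨ sum-cong-≗ (λ e → sum-cong-≗ (λ f → per-pair e f)) ⟩
    ∑[ e < m ] ∑[ f < m ] (a * a * (δᶜ e f * (mem v e * mem v f)))
      ≡⟨ trans (sum-cong-≗ (λ e → sym (*-distribˡ-sum (a * a) (λ f → δᶜ e f * (mem v e * mem v f)))))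
               (sym (*-distribˡ-sum (a * a) (λ e → ∑[ f < m ] (δᶜ e f * (mem v e * mem v f))))) ⟩
    a * a * pairs v                                        ∎
    where
    open ≡-Reasoning
    a : ℕ
    a = r ∸ 1
    T : Fin n → Fin n → Fin m → Fin m → ℕ
    T u w e f = δᶜ e f * (arm u v e * arm w v f)
    per-pair : ∀ e f → ∑[ u < n ] ∑[ w < n ] T u w e f ≡ a * a * (δᶜ e f * (mem v e * mem v f))
    per-pair e f = begin
      ∑[ u < n ] ∑[ w < n ] (δᶜ e f * (arm u v e * arm w v f))
        ≡⟨ sum-cong-≗ (λ u → sym (*-distribˡ-sum (δᶜ e f) (λ w → arm u v e * arm w v f))) ⟩
      ∑[ u < n ] (δᶜ e f * ∑[ w < n ] (arm u v e * arm w v f))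
        ≡⟨ *-distribˡ-sum (δᶜ e f) (λ u → ∑[ w < n ] (arm u v e * arm w v f)) ⟨
      δᶜ e f * ∑[ u < n ] ∑[ w < n ] (arm u v e * arm w v f)
        ≡⟨ cong (δᶜ e f *_) (sym (∑-product (λ u → arm u v e) (λ w → arm w v f))) ⟩
      δᶜ e f * (∑[ u < n ] arm u v e * ∑[ w < n ] arm w v f)
        ≡⟨ cong (δᶜ e f *_) (cong₂ _*_ (∑-arm v e) (∑-arm v f)) ⟩
      δᶜ e f * (mem v e * a * (mem v f * a))
        ≡⟨ rearrange (δᶜ e f) (mem v e) (mem v f) a ⟩
      a * a * (δᶜ e f * (mem v e * mem v f))                 ∎
      where
      rearrange : ∀ d x y a → d * (x * a * (y * a)) ≡ a * a * (d * (x * y))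
      rearrange = solve-∀

  all-cherries : ∑[ u < n ] ∑[ w < n ] ∑[ v < n ] cherries u v w ≡ (r ∸ 1) * (r ∸ 1) * ∑[ v < n ] pairs v
  all-cherries = begin
    ∑[ u < n ] ∑[ w < n ] ∑[ v < n ] cherries u v w  ≡⟨ ∑-comm₃ (λ v u w → cherries u v w) ⟨
    ∑[ v < n ] ∑[ u < n ] ∑[ w < n ] cherries u v w  ≡⟨ sum-cong-≗ ∑-cherries ⟩
    ∑[ v < n ] ((r ∸ 1) * (r ∸ 1) * pairs v)         ≡⟨ *-distribˡ-sum ((r ∸ 1) * (r ∸ 1)) pairs ⟨
    (r ∸ 1) * (r ∸ 1) * ∑[ v < n ] pairs v           ∎
    where open ≡-Reasoning

slack : ℕ → ℕ → ℕ
slack r s = 2 * (s * (1 + (r + r))) * (r * r * r) + (r ∸ 1) * (r ∸ 1) * r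

module Fans {n r : ℕ} (H : Hypergraph n r) (linear : Geometry.Linear H)
            (s : ℕ) (K₂-free : ¬ ContainsBerge H (K₂ (suc s))) where
  open Hypergraph H
  open Geometry H
  open Incidences H
  open Cherries H linear

  clashes : {S : Fin n → Set} → (∀ x → Dec (S x)) → Fin n → Fin n → Fin n → ℕ
  clashes S? a b g = ∑[ x < n ] (𝟙 (S? x) * (δᶜ g x * (common₃ a g x + common₃ b g x)))

  -- A decidable set S of spokes between a and b is covered by at most s of its
  -- members: a greedily chosen maximal conflict-free subset of S has at most s
  -- elements, as t of them would form a Berge-K_{2,t}.
  module Hubs {S : Fin n → Set} (S? : ∀ x → Dec (S x)) (a b : Fin n)
              (spokes : ∀ {x} → S x → Spoke a b x) where
    open Greedy S? (conflict? a b) (inj₁ refl) conflict-sym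
    open MaximalIndependent maximalIndependent public

    -- The first t hubs would form a Berge-K_{2,t}.
    few : size ≤ s
    few with size ≤? s
    ... | yes size≤s = size≤s
    ... | no size≰s = ⊥-elim (K₂-free (berge-K₂ (λ k → member (first k))
                                         (λ k → spokes (member∈P (first k)))
                                         (λ k<l → independent (first-mono k<l))))
      where
      t≤size : suc s ≤ size
      t≤size = ≰⇒> size≰s
      first : Fin (suc s) → Fin size
      first k = Fin.inject≤ k t≤size
      first-mono : ∀ {k l} → k Fin.< l → first k Fin.< first l
      first-mono {k} {l} = subst₂ _<_ (sym (FinP.toℕ-inject≤ k t≤size)) (sym (FinP.toℕ-inject≤ l t≤size))

    -- Every element of S conflicts with some hub, so |S| ≤ ∑_hubs (1 + clashes).
    covered : ∑[ x < n ] 𝟙 (S? x) ≤ ∑[ k < size ] (1 + clashes S? a b (member k))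
    covered = ≤-trans covering (∑-mono (λ k → per-hub (member k)))
      where
      -- g conflicts with itself and otherwise only through common hyperedges.
      per-hub : ∀ g → ∑[ x < n ] (𝟙 (S? x) * 𝟙 (conflict? a b g x)) ≤ 1 + clashes S? a b g
      per-hub g = begin
        ∑[ x < n ] (𝟙 (S? x) * 𝟙 (conflict? a b g x))
          ≤⟨ ∑-mono (λ x → *-monoʳ-≤ (𝟙 (S? x)) (conflict-count a b g x)) ⟩
        ∑[ x < n ] (𝟙 (S? x) * (δ g x + c x))
          ≡⟨ sum-cong-≗ (λ x → *-distribˡ-+ (𝟙 (S? x)) (δ g x) (c x)) ⟩
        ∑[ x < n ] (𝟙 (S? x) * δ g x + 𝟙 (S? x) * c x)
          ≡⟨ ∑-distrib-+ (λ x → 𝟙 (S? x) * δ g x) (λ x → 𝟙 (S? x) * c x) ⟩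
        ∑[ x < n ] (𝟙 (S? x) * δ g x) + clashes S? a b g
          ≤⟨ +-monoˡ-≤ _ (≤-trans (∑-mono (λ x → ≤1-scale (δ g x) (𝟙≤1 (S? x)))) self) ⟩
        1 + clashes S? a b g ∎
        where
        open ≤-Reasoning
        c : Fin n → ℕ
        c x = δᶜ g x * (common₃ a g x + common₃ b g x)
        self : ∑[ x < n ] δ g x ≤ 1
        self = ≤-reflexive (trans (sum-cong-≗ (λ x → sym (*-identityʳ (δ g x)))) (∑-δ g (λ _ → 1)))

  -- At most s(2r + 1) vertices are spokes between two given centres: a spoke g
  -- shares a hyperedge with a (resp. b) in at most one way, so it conflicts
  -- with at most 2r others.
  spokes-bound : ∀ a b → ∑[ x < n ] 𝟙 (spoke? a b x) ≤ s * (1 + (r + r))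
  spokes-bound a b = begin
    ∑[ x < n ] 𝟙 (spoke? a b x)                              ≤⟨ covered ⟩
    ∑[ k < size ] (1 + clashes (spoke? a b) a b (member k))  ≤⟨ ∑-mono (λ k → +-monoʳ-≤ 1 (spoke-clashes (member∈P k))) ⟩
    ∑[ k < size ] (1 + (r + r))                              ≡⟨ ∑-const size (1 + (r + r)) ⟩
    size * (1 + (r + r))                                     ≤⟨ *-monoˡ-≤ (1 + (r + r)) few ⟩
    s * (1 + (r + r))                                        ∎
    where
    open ≤-Reasoning
    open Hubs (spoke? a b) a b (λ sp → sp)
    r*≤r : ∀ {c} → c ≤ 1 → r * c ≤ r
    r*≤r c≤1 = ≤-trans (*-monoʳ-≤ r c≤1) (≤-reflexive (*-identityʳ r))
    spoke-clashes : ∀ {g} → Spoke a b g → clashes (spoke? a b) a b g ≤ r + r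
    spoke-clashes {g} sp = begin
      clashes (spoke? a b) a b g
        ≤⟨ ∑-mono (λ x → ≤-trans (≤1-scale _ (𝟙≤1 (spoke? a b x))) (≤1-scale _ (𝟙≤1 (¬? (g ≟ x))))) ⟩
      ∑[ x < n ] (common₃ a g x + common₃ b g x)
        ≡⟨ ∑-distrib-+ (common₃ a g) (common₃ b g) ⟩
      ∑[ x < n ] common₃ a g x + ∑[ x < n ] common₃ b g x
        ≡⟨ cong₂ _+_ (∑-common₃ a g) (∑-common₃ b g) ⟩
      r * common a g + r * common b g
        ≤⟨ +-mono-≤ (r*≤r (common≤1 (Spoke.a≢x sp))) (r*≤r (common≤1 (Spoke.b≢x sp))) ⟩
      r + r ∎

  middles-bound : ∀ u w → ∑[ v < n ] 𝟙 (middle? u w v) ≤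
                          s + ∑[ g < n ] (𝟙 (middle? u w g) * clashes (middle? u w) u w g)
  middles-bound u w = begin
    ∑[ v < n ] 𝟙 (middle? u w v)                                   ≤⟨ covered ⟩
    ∑[ k < size ] (1 + F (member k))                               ≡⟨ ∑-distrib-+ (λ _ → 1) (λ k → F (member k)) ⟩
    ∑[ k < size ] 1 + ∑[ k < size ] F (member k)
      ≤⟨ +-mono-≤ (≤-trans (≤-reflexive (trans (∑-const size 1) (*-identityʳ size))) few) hubs-inside ⟩
    s + ∑[ g < n ] (𝟙 (middle? u w g) * F g)                       ∎
    where
    open ≤-Reasoning
    open Hubs (middle? u w) u w middle⇒spoke
    F : Fin n → ℕ
    F = clashes (middle? u w) u w
    -- The hubs are distinct middle vertices.
    hubs-inside : ∑[ k < size ] F (member k) ≤ ∑[ g < n ] (𝟙 (middle? u w g) * F g)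
    hubs-inside = begin
      ∑[ k < size ] F (member k)
        ≡⟨ sum-cong-≗ (λ k → sym (trans (cong (_* F (member k)) (𝟙-yes (middle? u w (member k)) (member∈P k)))
                                         (*-identityˡ (F (member k))))) ⟩
      ∑[ k < size ] (𝟙 (middle? u w (member k)) * F (member k))
        ≤⟨ ∑-injection member member-injective (λ g → 𝟙 (middle? u w g) * F g) ⟩
      ∑[ g < n ] (𝟙 (middle? u w g) * F g) ∎

  twin : Fin n → Fin n → Fin n → Fin n → ℕ
  twin u w g x = 𝟙 (middle? u w g) * (𝟙 (middle? u w x) * δᶜ g x)

  twin-sym : ∀ u w g x → twin u w g x ≡ twin w u g x
  twin-sym u w g x = cong₂ (λ p q → p * (q * δᶜ g x)) (middle-sym u w g) (middle-sym u w x)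

  -- If u, g, x share a hyperedge, every w making g and x twins with u is a
  -- spoke between g and x.
  ∑-twin : ∀ u g x → 1 ≤ common₃ u g x → ∑[ w < n ] twin u w g x ≤ s * (1 + (r + r))
  ∑-twin u g x pos = ≤-trans (∑-mono (λ w → ≤-𝟙 (spoke? g x w) (twin≤1 w) (twin⇒spoke w))) (spokes-bound g x)
    where
    twin≤1 : ∀ w → twin u w g x ≤ 1
    twin≤1 w = *-≤1 (𝟙≤1 (middle? u w g)) (*-≤1 (𝟙≤1 (middle? u w x)) (𝟙≤1 (¬? (g ≟ x))))
    twin⇒spoke : ∀ w → 1 ≤ twin u w g x → Spoke g x w
    twin⇒spoke w tw with *-pos⁻ (𝟙 (middle? u w g)) _ tw
    ... | mid-g , rest with *-pos⁻ (𝟙 (middle? u w x)) (δᶜ g x) rest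
    ...   | mid-x , g≢x = middles⇒spoke {u} {g} {x} {w} (common₃⇒collinear pos) (𝟙-sound (¬? (g ≟ x)) g≢x)
                            (𝟙-sound (middle? u w g) mid-g) (𝟙-sound (middle? u w x) mid-x)

  -- Summed over all u, w, the clashes among middle vertices are O(m): a clash
  -- of g and x through u is charged to the collinear triple (u, g, x), which by
  -- ∑-twin is charged at most s(2r + 1) times; clashes through w are symmetric.
  all-clashes : ∑[ u < n ] ∑[ w < n ] ∑[ g < n ] (𝟙 (middle? u w g) * clashes (middle? u w) u w g)
                ≤ 2 * (s * (1 + (r + r))) * (r * r * r * m)
  all-clashes = begin
    ∑[ u < n ] ∑[ w < n ] ∑[ g < n ] (𝟙 (middle? u w g) * clashes (middle? u w) u w g)
      ≡⟨ sum-cong-≗ (λ u → sum-cong-≗ (λ w → sum-cong-≗ (λ g → expand u w g))) ⟩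
    ∑[ u < n ] ∑[ w < n ] ∑[ g < n ] ∑[ x < n ] T u w g x
      ≡⟨ sum-cong-≗ (λ u → ∑-comm₃ (T u)) ⟩
    ∑[ u < n ] ∑[ g < n ] ∑[ x < n ] ∑[ w < n ] T u w g x
      ≡⟨ ∑-comm₃ (λ u g x → ∑[ w < n ] T u w g x) ⟩
    ∑[ g < n ] ∑[ x < n ] ∑[ u < n ] ∑[ w < n ] T u w g x
      ≤⟨ ∑-mono (λ g → ∑-mono (λ x → per-pair g x)) ⟩
    ∑[ g < n ] ∑[ x < n ] (κ * ∑[ u < n ] common₃ u g x)
      ≡⟨ trans (sum-cong-≗ (λ g → sym (*-distribˡ-sum κ (λ x → ∑[ u < n ] common₃ u g x))))
               (sym (*-distribˡ-sum κ (λ g → ∑[ x < n ] ∑[ u < n ] common₃ u g x))) ⟩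
    κ * ∑[ g < n ] ∑[ x < n ] ∑[ u < n ] common₃ u g x
      ≡⟨ cong (κ *_) (trans (sym (∑-comm₃ common₃)) triples) ⟩
    κ * (r * r * r * m) ∎
    where
    open ≤-Reasoning
    fan κ : ℕ
    fan = s * (1 + (r + r))
    κ = 2 * fan
    T : Fin n → Fin n → Fin n → Fin n → ℕ
    T u w g x = (common₃ u g x + common₃ w g x) * twin u w g x

    expand : ∀ u w g → 𝟙 (middle? u w g) * clashes (middle? u w) u w g ≡ ∑[ x < n ] T u w g x
    expand u w g = trans (*-distribˡ-sum (𝟙 (middle? u w g)) (λ x → 𝟙 (middle? u w x) * (δᶜ g x * c x)))
                         (sum-cong-≗ (λ x → regroup (𝟙 (middle? u w g)) (𝟙 (middle? u w x)) (δᶜ g x) (c x)))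
      where
      c : Fin n → ℕ
      c x = common₃ u g x + common₃ w g x
      regroup : ∀ a b d c → a * (b * (d * c)) ≡ c * (a * (b * d))
      regroup = solve-∀

    through-u : ∀ g x → ∑[ u < n ] ∑[ w < n ] (common₃ u g x * twin u w g x) ≤ ∑[ u < n ] common₃ u g x * fan
    through-u g x = begin
      ∑[ u < n ] ∑[ w < n ] (common₃ u g x * twin u w g x)
        ≡⟨ sum-cong-≗ (λ u → sym (*-distribˡ-sum (common₃ u g x) (λ w → twin u w g x))) ⟩
      ∑[ u < n ] (common₃ u g x * ∑[ w < n ] twin u w g x)
        ≤⟨ ∑-mono (λ u → *-mono-pos (common₃ u g x) (∑-twin u g x)) ⟩
      ∑[ u < n ] (common₃ u g x * fan)
        ≡⟨ *-distribʳ-sum fan (λ u → common₃ u g x) ⟨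
      ∑[ u < n ] common₃ u g x * fan ∎

    through-w : ∀ g x → ∑[ u < n ] ∑[ w < n ] (common₃ w g x * twin u w g x)
                      ≡ ∑[ u < n ] ∑[ w < n ] (common₃ u g x * twin u w g x)
    through-w g x = trans (∑-comm (λ u w → common₃ w g x * twin u w g x))
                          (sum-cong-≗ (λ w → sum-cong-≗ (λ u → cong (common₃ w g x *_) (twin-sym u w g x))))

    per-pair : ∀ g x → ∑[ u < n ] ∑[ w < n ] T u w g x ≤ κ * ∑[ u < n ] common₃ u g x
    per-pair g x = begin
      ∑[ u < n ] ∑[ w < n ] T u w g x
        ≡⟨ sum-cong-≗ (λ u → sum-cong-≗ (λ w → *-distribʳ-+ (twin u w g x) (common₃ u g x) (common₃ w g x))) ⟩
      ∑[ u < n ] ∑[ w < n ] (U u w + W u w)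
        ≡⟨ trans (sum-cong-≗ (λ u → ∑-distrib-+ (U u) (W u))) (∑-distrib-+ (λ u → sum (U u)) (λ u → sum (W u))) ⟩
      ∑[ u < n ] ∑[ w < n ] U u w + ∑[ u < n ] ∑[ w < n ] W u w
        ≡⟨ cong (∑[ u < n ] ∑[ w < n ] U u w +_) (through-w g x) ⟩
      ∑[ u < n ] ∑[ w < n ] U u w + ∑[ u < n ] ∑[ w < n ] U u w
        ≤⟨ +-mono-≤ (through-u g x) (through-u g x) ⟩
      C * fan + C * fan
        ≡⟨ double C fan ⟩
      κ * C ∎
      where
      U W : Fin n → Fin n → ℕ
      U u w = common₃ u g x * twin u w g x
      W u w = common₃ w g x * twin u w g x
      C : ℕ
      C = ∑[ u < n ] common₃ u g x
      double : ∀ c b → c * b + c * b ≡ 2 * b * c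
      double = solve-∀

  -- Each pair (u, w) has at most s middle vertices up to clashes, so
  -- there are at most s n² + O(m) paths of length two.
  cherries-bound : ∑[ u < n ] ∑[ w < n ] ∑[ v < n ] cherries u v w
                   ≤ n * (n * s) + 2 * (s * (1 + (r + r))) * (r * r * r * m)
  cherries-bound = begin
    ∑[ u < n ] ∑[ w < n ] ∑[ v < n ] cherries u v w
      ≤⟨ ∑-mono (λ u → ∑-mono (λ w → ∑-mono (λ v → cherries≤middle u v w))) ⟩
    ∑[ u < n ] ∑[ w < n ] ∑[ v < n ] 𝟙 (middle? u w v)
      ≤⟨ ∑-mono (λ u → ∑-mono (λ w → middles-bound u w)) ⟩
    ∑[ u < n ] ∑[ w < n ] (s + Clash u w)
      ≡⟨ trans (sum-cong-≗ (λ u → ∑-distrib-+ (λ _ → s) (Clash u)))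
               (∑-distrib-+ (λ _ → ∑[ w < n ] s) (λ u → sum (Clash u))) ⟩
    ∑[ u < n ] ∑[ w < n ] s + ∑[ u < n ] ∑[ w < n ] Clash u w
      ≤⟨ +-mono-≤ (≤-reflexive (trans (∑-const n (∑[ w < n ] s)) (cong (n *_) (∑-const n s)))) all-clashes ⟩
    n * (n * s) + 2 * (s * (1 + (r + r))) * (r * r * r * m) ∎
    where
    open ≤-Reasoning
    Clash : Fin n → Fin n → ℕ
    Clash u w = ∑[ g < n ] (𝟙 (middle? u w g) * clashes (middle? u w) u w g)

  -- The counting inequality behind the theorem: with X = r(r - 1)m,
  -- X² = (r - 1)² (∑ deg)² ≤ (r - 1)² n ∑ deg² = n · #paths + O(mn) ≤ s n³ + O(Xn).
  key-inequality : 1 ≤ r * (r ∸ 1) →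
    r * (r ∸ 1) * m * (r * (r ∸ 1) * m) ≤ s * n ^ 3 + slack r s * (r * (r ∸ 1) * m) * n
  key-inequality r[r∸1]≥1 = begin
    X * X                                                  ≡⟨ square-X r a m ⟩
    a * a * (r * m * (r * m))                              ≡⟨ cong (λ d → a * a * (d * d)) handshake ⟨
    a * a * (sum deg * sum deg)                            ≤⟨ *-monoʳ-≤ (a * a) (cauchy-schwarz deg) ⟩
    a * a * (n * ∑[ v < n ] (deg v * deg v))               ≡⟨ cong (λ d → a * a * (n * d)) ∑-deg² ⟩
    a * a * (n * (sum pairs + r * m))                      ≡⟨ spread a n (sum pairs) (r * m) ⟩
    n * (a * a * sum pairs) + n * (a * a * (r * m))        ≡⟨ cong (λ p → n * p + n * (a * a * (r * m))) all-cherries ⟨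
    n * paths + n * (a * a * (r * m))                      ≤⟨ +-monoˡ-≤ _ (*-monoʳ-≤ n cherries-bound) ⟩
    n * (n * (n * s) + κ * (r * r * r * m)) + n * (a * a * (r * m))
                                                           ≡⟨ collect n s κ m a r ⟩
    s * n ^ 3 + m * n * slack r s
                           ≤⟨ +-monoʳ-≤ (s * n ^ 3) (*-monoˡ-≤ (slack r s) (*-monoˡ-≤ n m≤X)) ⟩
    s * n ^ 3 + X * n * slack r s                          ≡⟨ cong (s * n ^ 3 +_) (reorder X n (slack r s)) ⟩
    s * n ^ 3 + slack r s * X * n                          ∎
    where
    open ≤-Reasoning
    a X κ paths : ℕ
    a = r ∸ 1
    X = r * a * m
    κ = 2 * (s * (1 + (r + r)))
    paths = ∑[ u < n ] ∑[ w < n ] ∑[ v < n ] cherries u v w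
    m≤X : m ≤ X
    m≤X = subst (_≤ X) (*-identityˡ m) (*-monoˡ-≤ m r[r∸1]≥1)
    square-X : ∀ r a m → r * a * m * (r * a * m) ≡ a * a * (r * m * (r * m))
    square-X = solve-∀
    spread : ∀ a n p q → a * a * (n * (p + q)) ≡ n * (a * a * p) + n * (a * a * q)
    spread = solve-∀
    collect : ∀ n s κ m a r → n * (n * (n * s) + κ * (r * r * r * m)) + n * (a * a * (r * m))
                            ≡ s * (n * (n * (n * 1))) + m * n * (κ * (r * r * r) + a * a * r)
    collect = solve-∀
    reorder : ∀ x n c → x * n * c ≡ c * x * n
    reorder = solve-∀

-- From X² ≤ A + C X n conclude (X - C n)² ≤ A: if X = Y + C n then
-- X² = Y² + C Y n + C X n.
square-bound : ∀ X C n A → X * X ≤ A + C * X * n → (X ∸ C * n) ^ 2 ≤ A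
square-bound X C n A X²≤ with ≤-total X (C * n)
... | inj₁ X≤Cn rewrite m≤n⇒m∸n≡0 X≤Cn = z≤n
... | inj₂ Cn≤X = ≤-trans (m≤m+n _ _) (+-cancelʳ-≤ (C * X * n) _ _ expanded)
  where
  Y : ℕ
  Y = X ∸ C * n
  X≡ : Y + C * n ≡ X
  X≡ = m∸n+n≡m Cn≤X
  expand : ∀ Y C n → (Y + C * n) * (Y + C * n) ≡ Y * (Y * 1) + C * Y * n + C * (Y + C * n) * n
  expand = solve-∀
  expanded : Y ^ 2 + C * Y * n + C * X * n ≤ A + C * X * n
  expanded = subst (λ Z → Y ^ 2 + C * Y * n + C * Z * n ≤ A + C * X * n) X≡
               (subst (_≤ A + C * X * n) (trans (cong (λ Z → Z * Z) (sym X≡)) (expand Y C n)) X²≤)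

mainTheorem6 : (r t : ℕ) → 2 ≤ r → 2 ≤ t →
    ∃[ C ] ((n : ℕ) (H : Hypergraph n r) →
    ¬ ContainsBerge H C₂ → ¬ ContainsBerge H (K₂ t) →
    (r * (r ∸ 1) * Hypergraph.m H ∸ C * n) ^ 2 ≤ (t ∸ 1) * n ^ 3)
mainTheorem6 r zero _ ()
mainTheorem6 r (suc s) 2≤r _ = slack r s , bound
  where
  r[r∸1]≥1 : 1 ≤ r * (r ∸ 1)
  r[r∸1]≥1 = *-mono-≤ (≤-trans (s≤s z≤n) 2≤r) (∸-monoˡ-≤ 1 2≤r)
  bound : (n : ℕ) (H : Hypergraph n r) → ¬ ContainsBerge H C₂ → ¬ ContainsBerge H (K₂ (suc s)) →
          (r * (r ∸ 1) * Hypergraph.m H ∸ slack r s * n) ^ 2 ≤ s * n ^ 3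
  bound n H C₂-free K₂-free = square-bound _ (slack r s) n (s * n ^ 3)
    (Fans.key-inequality H (Geometry.C₂-free⇒linear H C₂-free) s K₂-free r[r∸1]≥1)
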